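{- Let $\Gamma$ be an $X$-symmetric graph with an $X$-invariant partition $\mathcal B$ of $V(\Gamma)$ such that $\Gamma_{\mathcal B}$ is connected and $(X,2)$-arc-transitive. Let $B\in\mathcal B$ and $C,D\in\Gamma_{\mathcal B}(B)$ with $C\ne D$. If $\Gamma[B,C]$ is connected and $\Gamma(C)\cap B\cap\Gamma(D)\ne\emptyset$, then $\Gamma$ is connected.
   Context: Graphs are finite, simple, undirected. $\Gamma$ is $X$-symmetric if $X$ acts on $V(\Gamma)$ preserving adjacency, transitively on vertices and on arcs; $(X,2)$-arc-transitive if moreover transitive on $2$-arcs (sequences $(\alpha_0,\alpha_1,\alpha_2)$ with consecutive vertices adjacent and $\alpha_0\ne\alpha_2$). For an $X$-invariant partition $\mathcal B$ (blocks permuted by $X$), $\Gamma_{\mathcal B}$ is the quotient graph on $\mathcal B$ ($B\sim C$ iff some vertex of $B$ is adjacent to some vertex of $C$), $\Gamma_{\mathcal B}(B)$ the neighbourhood of $B$ in it, $\Gamma(C)=\bigcup_{\mathfrak u\in C}\Gamma(\mathfrak u)$, and $\Gamma[B,C]$ is the bipartite subgraph of $\Gamma$ induced on $(\Gamma(C)\cap B)\cup(\Gamma(B)\cap C)$. -}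

module Defs where

open import Level using (0ℓ)
open import Data.Nat using (ℕ)
open import Data.Fin using (Fin)
open import Data.Product using (Σ; ∃; ∃-syntax; _×_; _,_)
open import Data.Sum using (_⊎_)
open import Relation.Nullary using (¬_)
open import Relation.Binary.PropositionalEquality using (_≡_; _≢_)
open import Relation.Binary.Construct.Closure.ReflexiveTransitive using (Star)
open import Algebra.Bundles using (Group)

record Graph (n : ℕ) : Set₁ where
  field
    _~_    : Fin n → Fin n → Set
    sym    : ∀ {u v} → u ~ v → v ~ u
    irrefl : ∀ {u} → ¬ (u ~ u)

Connected : {V : Set} → (V → V → Set) → Set
Connected {V} R = (u v : V) → Star R u v

record Action (X : Group 0ℓ 0ℓ) (n : ℕ) : Set where
  open Group X
  field
    act      : Carrier → Fin n → Fin n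
    act-ε    : ∀ v → act ε v ≡ v
    act-∙    : ∀ g h v → act (g ∙ h) v ≡ act g (act h v)
    act-cong : ∀ {g h} v → g ≈ h → act g v ≡ act h v

module _ {X : Group 0ℓ 0ℓ} {n : ℕ} (Γ : Graph n) (α : Action X n) where
  open Group X using (Carrier)
  open Graph Γ
  open Action α

  PreservesAdj : Set
  PreservesAdj = ∀ g u v → (u ~ v → act g u ~ act g v) × (act g u ~ act g v → u ~ v)

  Symmetric : Set
  Symmetric = PreservesAdj
            × (∀ u v → ∃[ g ] act g u ≡ v)
            × (∀ u v u' v' → u ~ v → u' ~ v' → ∃[ g ] (act g u ≡ u' × act g v ≡ v'))

  record InvPartition (m : ℕ) : Set where
    field
      part      : Fin n → Fin m
      nonempty  : ∀ (B : Fin m) → ∃[ u ] part u ≡ B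
      invariant : ∀ g u v → part u ≡ part v → part (act g u) ≡ part (act g v)

  module _ {m : ℕ} (𝓑 : InvPartition m) where
    open InvPartition 𝓑

    MapsBlock : Carrier → Fin m → Fin m → Set
    MapsBlock g B C = ∀ u → part u ≡ B → part (act g u) ≡ C

    QAdj : Fin m → Fin m → Set
    QAdj B C = B ≢ C × ∃[ u ] ∃[ v ] (part u ≡ B × part v ≡ C × u ~ v)

    Quotient2ArcTransitive : Set
    Quotient2ArcTransitive =
        (∀ B C → ∃[ g ] MapsBlock g B C)
      × (∀ B₀ B₁ C₀ C₁ → QAdj B₀ B₁ → QAdj C₀ C₁ →
           ∃[ g ] (MapsBlock g B₀ C₀ × MapsBlock g B₁ C₁))
      × (∀ B₀ B₁ B₂ C₀ C₁ C₂ →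
           QAdj B₀ B₁ → QAdj B₁ B₂ → B₀ ≢ B₂ →
           QAdj C₀ C₁ → QAdj C₁ C₂ → C₀ ≢ C₂ →
           ∃[ g ] (MapsBlock g B₀ C₀ × MapsBlock g B₁ C₁ × MapsBlock g B₂ C₂))

    -- vertex set of Γ[B,C]: (Γ(C) ∩ B) ∪ (Γ(B) ∩ C)
    InBip : Fin m → Fin m → Fin n → Set
    InBip B C u = (part u ≡ B × ∃[ v ] (part v ≡ C × u ~ v))
                ⊎ (part u ≡ C × ∃[ v ] (part v ≡ B × u ~ v))

    BipAdj : Fin m → Fin m → Fin n → Fin n → Set
    BipAdj B C u v = u ~ v × ((part u ≡ B × part v ≡ C) ⊎ (part u ≡ C × part v ≡ B))

    BipConnected : Fin m → Fin m → Set
    BipConnected B C = ∀ u v → InBip B C u → InBip B C v → Star (BipAdj B C) u v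

module Submission where

-- Write x ~* y for "x and y are joined by a walk in Γ".
--   (1) Since X acts by automorphisms and is transitive on the arcs of the
--       quotient Γ_𝓑, the connectivity of Γ[B,C] transports to Γ[P,Q] for
--       every quotient edge P ~ Q: any two vertices of Γ[P,Q] satisfy ~*.
--   (2) By vertex-transitivity every vertex x has a neighbour in some block
--       adjacent to the block of x (move the given edge u—v onto x).
--   (3) Two vertices x, y of one block P are joined: pick neighbours x', y'
--       in adjacent blocks P', P''.  If P' = P'' use (1) for Γ[P,P'].
--       Otherwise (P',P,P'') is a 2-arc of Γ_𝓑, and 2-arc-transitivity moves
--       (C,B,D) onto it; the image z of the vertex u ∈ B with neighbours in
--       C and D lies in both Γ[P,P'] and Γ[P,P''], so x ~* z ~* y by (1).
--   (4) A walk in the connected quotient lifts, using (3) inside each block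
--       and one edge of Γ between consecutive blocks, to a walk in Γ.

open import Defs
open import Level using (0ℓ)
open import Data.Nat using (ℕ)
open import Data.Fin using (Fin; _≟_)
open import Data.Product using (∃-syntax; _×_; _,_; proj₁; proj₂)
open import Data.Sum using (inj₁; inj₂)
open import Relation.Nullary using (yes; no)
open import Relation.Binary.PropositionalEquality
  using (_≡_; _≢_; refl; sym; trans; cong; subst; subst₂; module ≡-Reasoning)
open import Relation.Binary.Construct.Closure.ReflexiveTransitive
  using (Star; ε; _◅_; _◅◅_; gmap; map)
open import Algebra.Bundles using (Group)

module Automorphisms {X : Group 0ℓ 0ℓ} {n : ℕ} (Γ : Graph n) (α : Action X n)
    (pres : PreservesAdj Γ α) where
  open Group X using (_∙_; _⁻¹; inverseˡ; inverseʳ) renaming (ε to e)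
  open Graph Γ using (_~_)
  open Action α
  open ≡-Reasoning

  act-inverseˡ : ∀ g x → act (g ⁻¹) (act g x) ≡ x
  act-inverseˡ g x = begin
    act (g ⁻¹) (act g x) ≡⟨ act-∙ (g ⁻¹) g x ⟨
    act (g ⁻¹ ∙ g) x     ≡⟨ act-cong x (inverseˡ g) ⟩
    act e x              ≡⟨ act-ε x ⟩
    x                    ∎

  act-inverseʳ : ∀ g x → act g (act (g ⁻¹) x) ≡ x
  act-inverseʳ g x = begin
    act g (act (g ⁻¹) x) ≡⟨ act-∙ g (g ⁻¹) x ⟨
    act (g ∙ g ⁻¹) x     ≡⟨ act-cong x (inverseʳ g) ⟩
    act e x              ≡⟨ act-ε x ⟩
    x                    ∎

  map-walk : ∀ g {x y} → Star _~_ x y → Star _~_ (act g x) (act g y)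
  map-walk g = gmap (act g) (λ {u} {v} → proj₁ (pres g u v))

  walk-from-preimages : ∀ g {x y} →
    Star _~_ (act (g ⁻¹) x) (act (g ⁻¹) y) → Star _~_ x y
  walk-from-preimages g w =
    subst₂ (Star _~_) (act-inverseʳ g _) (act-inverseʳ g _) (map-walk g w)

module Blocks {X : Group 0ℓ 0ℓ} {n m : ℕ} (Γ : Graph n) (α : Action X n)
    (pres : PreservesAdj Γ α) (𝓑 : InvPartition Γ α m) where
  open Group X using (_⁻¹)
  open Graph Γ using (_~_)
  open Action α
  open InvPartition 𝓑
  open Automorphisms Γ α pres

  -- If g maps block P onto Q then g⁻¹ maps Q back into P (blocks are nonempty).
  maps-back : ∀ g {P Q} x → MapsBlock Γ α 𝓑 g P Q → part x ≡ Q →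
              part (act (g ⁻¹) x) ≡ P
  maps-back g {P} x gPQ px with nonempty P
  ... | y , py =
    trans (sym (invariant (g ⁻¹) (act g y) x (trans (gPQ y py) (sym px))))
          (trans (cong part (act-inverseˡ g y)) py)

  pull-InBip : ∀ g {B C P Q} →
    MapsBlock Γ α 𝓑 g B P → MapsBlock Γ α 𝓑 g C Q →
    ∀ z → InBip Γ α 𝓑 P Q z → InBip Γ α 𝓑 B C (act (g ⁻¹) z)
  pull-InBip g gBP gCQ z (inj₁ (pz , v , pv , zv)) =
    inj₁ (maps-back g z gBP pz , act (g ⁻¹) v , maps-back g v gCQ pv ,
          proj₁ (pres (g ⁻¹) z v) zv)
  pull-InBip g gBP gCQ z (inj₂ (pz , v , pv , zv)) =
    inj₂ (maps-back g z gCQ pz , act (g ⁻¹) v , maps-back g v gBP pv ,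
          proj₁ (pres (g ⁻¹) z v) zv)

  transport-BipConnected : ∀ g {B C P Q} →
    MapsBlock Γ α 𝓑 g B P → MapsBlock Γ α 𝓑 g C Q → BipConnected Γ α 𝓑 B C →
    ∀ x y → InBip Γ α 𝓑 P Q x → InBip Γ α 𝓑 P Q y → Star _~_ x y
  transport-BipConnected g gBP gCQ bc x y x∈ y∈ =
    walk-from-preimages g
      (map proj₁
        (bc _ _ (pull-InBip g gBP gCQ x x∈) (pull-InBip g gBP gCQ y y∈)))

  QAdj-sym : ∀ {P Q} → QAdj Γ α 𝓑 P Q → QAdj Γ α 𝓑 Q P
  QAdj-sym (P≢Q , a , b , pa , pb , ab) =
    (λ e → P≢Q (sym e)) , b , a , pb , pa , Graph.sym Γ ab

  edge-QAdj : ∀ {x y} → x ~ y → part x ≢ part y → QAdj Γ α 𝓑 (part x) (part y)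
  edge-QAdj {x} {y} xy ne = ne , x , y , refl , refl , xy

module Connectivity {X : Group 0ℓ 0ℓ} {n m : ℕ} (Γ : Graph n) (α : Action X n)
    (𝓑 : InvPartition Γ α m) (sy : Symmetric Γ α)
    (q2 : Quotient2ArcTransitive Γ α 𝓑)
    {B C D : Fin m}
    (qBC : QAdj Γ α 𝓑 B C) (qBD : QAdj Γ α 𝓑 B D) (C≢D : C ≢ D)
    (bc : BipConnected Γ α 𝓑 B C)
    {u v w : Fin n} (pu : InvPartition.part 𝓑 u ≡ B)
    (pv : InvPartition.part 𝓑 v ≡ C) (uv : Graph._~_ Γ u v)
    (pw : InvPartition.part 𝓑 w ≡ D) (uw : Graph._~_ Γ u w) where
  open Group X using (_⁻¹)
  open Graph Γ using (_~_)
  open Action α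
  open InvPartition 𝓑

  pres : PreservesAdj Γ α
  pres = proj₁ sy

  open Automorphisms Γ α pres
  open Blocks Γ α pres 𝓑

  _~*_ : Fin n → Fin n → Set
  _~*_ = Star _~_

  -- Step (1) for every quotient edge, via arc-transitivity of Γ_𝓑.
  bip-walk : ∀ {P Q} → QAdj Γ α 𝓑 P Q →
             ∀ x y → InBip Γ α 𝓑 P Q x → InBip Γ α 𝓑 P Q y → x ~* y
  bip-walk qPQ with proj₁ (proj₂ q2) _ _ _ _ qBC qPQ
  ... | g , gBP , gCQ = transport-BipConnected g gBP gCQ bc

  in-bip : ∀ {P Q x y} → part x ≡ P → part y ≡ Q → x ~ y → InBip Γ α 𝓑 P Q x
  in-bip px py xy = inj₁ (px , _ , py , xy)

  -- Step (2): every vertex has a neighbour in a different (hence adjacent)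
  -- block, namely the image of v under an element moving u to x.
  neighbour-out : ∀ x → ∃[ y ] (x ~ y × QAdj Γ α 𝓑 (part x) (part y))
  neighbour-out x with proj₁ (proj₂ sy) u x
  ... | g , gu≡x = act g v , xy , edge-QAdj xy different
    where
    xy : x ~ act g v
    xy = subst (_~ act g v) gu≡x (proj₁ (pres g u v) uv)
    -- g⁻¹ would otherwise put u and v into the same block, contradicting B ≢ C.
    different : part x ≢ part (act g v)
    different e = proj₁ qBC (begin
      B                           ≡⟨ sym pu ⟩
      part u                      ≡⟨ cong part (act-inverseˡ g u) ⟨
      part (act (g ⁻¹) (act g u)) ≡⟨ invariant (g ⁻¹) _ _ (trans (cong part gu≡x) e) ⟩
      part (act (g ⁻¹) (act g v)) ≡⟨ cong part (act-inverseˡ g v) ⟩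
      part v                      ≡⟨ pv ⟩
      C                           ∎)
      where open ≡-Reasoning

  -- Step (3), core case: x and y lie in one block P and have neighbours x', y'
  -- in blocks adjacent to P.  If those blocks coincide, Γ[P,P'] joins x, y;
  -- otherwise 2-arc-transitivity moves (C,B,D) onto the 2-arc (P',P,P''),
  -- and the image z of u lies in both Γ[P,P'] and Γ[P,P''].
  via-neighbours : ∀ {x y x' y'} → part x ≡ part y → x ~ x' → y ~ y' →
    QAdj Γ α 𝓑 (part x) (part x') → QAdj Γ α 𝓑 (part x) (part y') → x ~* y
  via-neighbours {x} {y} {x'} {y'} pxy xx' yy' qx qy with part x' ≟ part y'
  ... | yes e = bip-walk qx x y (in-bip refl refl xx') (in-bip (sym pxy) (sym e) yy')
  ... | no ne with proj₂ (proj₂ q2) C B D (part x') (part x) (part y')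
                     (QAdj-sym qBC) qBD C≢D (QAdj-sym qx) qy ne
  ... | g , gC , gB , gD =
    bip-walk qx x z (in-bip refl refl xx') (in-bip gu (gC v pv) (proj₁ (pres g u v) uv))
    ◅◅ bip-walk qy z y (in-bip gu (gD w pw) (proj₁ (pres g u w) uw))
                       (in-bip (sym pxy) refl yy')
    where
    z = act g u
    gu : part z ≡ part x
    gu = gB u pu

  same-block : ∀ x y → part x ≡ part y → x ~* y
  same-block x y pxy with neighbour-out x | neighbour-out y
  ... | x' , xx' , qx | y' , yy' , qy =
    via-neighbours pxy xx' yy' qx (subst (λ P → QAdj Γ α 𝓑 P (part y')) (sym pxy) qy)

  lift-walk : ∀ {P Q} → Star (QAdj Γ α 𝓑) P Q →
              ∀ x y → part x ≡ P → part y ≡ Q → x ~* y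
  lift-walk ε x y px py = same-block x y (trans px (sym py))
  lift-walk ((_ , a , b , pa , pb , ab) ◅ qs) x y px py =
    same-block x a (trans px (sym pa)) ◅◅ (ab ◅ lift-walk qs b y pb py)

lemma6p2 : {X : Group 0ℓ 0ℓ} {n m : ℕ} (Γ : Graph n) (α : Action X n)
    (𝓑 : InvPartition Γ α m) →
    Symmetric Γ α →
    Connected (QAdj Γ α 𝓑) →
    Quotient2ArcTransitive Γ α 𝓑 →
    (B C D : Fin m) →
    QAdj Γ α 𝓑 B C → QAdj Γ α 𝓑 B D → C ≢ D →
    BipConnected Γ α 𝓑 B C →
    (∃[ u ] (InvPartition.part 𝓑 u ≡ B
    × ∃[ v ] (InvPartition.part 𝓑 v ≡ C × Graph._~_ Γ u v)
    × ∃[ w ] (InvPartition.part 𝓑 w ≡ D × Graph._~_ Γ u w))) →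
    Connected (Graph._~_ Γ)
lemma6p2 Γ α 𝓑 sy quotient-connected q2 B C D qBC qBD C≢D bc
         (u , pu , v , (pv , uv) , w , pw , uw) x y =
  lift-walk (quotient-connected (part x) (part y)) x y refl refl
  where
  open InvPartition 𝓑 using (part)
  open Connectivity Γ α 𝓑 sy q2 qBC qBD C≢D bc pu pv uv pw uw
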